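{- Let $w\in A^*$ be a word of length $n$, and let $l^*$ be the adjoint of the left normed Lie bracketing of the free Lie ring. Write $l^*(w)=\sum_{i=1}^k\xi_i\,l^*(l_i)$ with $\xi_i\in\mathbb{Z}$, where $l_1,\dots,l_k$ are the Lyndon words of length $n$. Then either $c(w)=0$, or $c(w)$ equals the greatest common divisor of the nonzero coefficients of the monomials of $l^*(w)$, and also equals the greatest common divisor of the nonzero $\xi_i$.
   Context: $A$ is a finite totally ordered alphabet, ordered lexicographically on $A^*$; a nonempty word is a Lyndon word if it is strictly smaller than each of its proper nontrivial rotations (equivalently, than each of its proper nonempty suffixes). $\mathbb{Z}\langle A\rangle$ is the free associative ring with scalar product $(P,Q)=\sum_u(P,u)(Q,u)$, $(P,u)$ being the coefficient of $u$ in $P$. The free Lie ring $\mathcal{L}_{\mathbb{Z}}(A)$ is the Lie subring (bracket $[P,Q]=PQ-QP$) generated by $A$. The left normed bracketing $l$: $l(\epsilon)=0$, $l(a)=a$, $l(ua)=[l(u),a]$, extended linearly; $l^*$ is the linear endomorphism with $(l^*(u),v)=(l(v),u)$ for all words $u,v$. The elements $l^*(l_1),\dots,l^*(l_k)$ form a $\mathbb{Z}$-basis of the image under $l^*$ of the degree-$n$ homogeneous component, so the $\xi_i$ exist and are unique. $c(w)$ is the non-negative generator of the ideal $\{(P,w):P\in\mathcal{L}_{\mathbb{Z}}(A)\}$ of $\mathbb{Z}$. -}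

module Defs where

open import Data.Bool using (Bool; true; false; if_then_else_; _∧_)
open import Data.Nat as ℕ using (ℕ; zero; suc; _<ᵇ_; _≡ᵇ_)
open import Data.Nat.GCD using (gcd)
open import Data.Integer as ℤ using (ℤ; +_; ∣_∣)
open import Data.Fin as Fin using (Fin; toℕ)
open import Data.List using (List; []; _∷_; _++_; map; concatMap; foldl; foldr; filterᵇ; allFin; length)
open import Data.List.Properties using (≡-dec)
open import Data.Product using (_×_; _,_; proj₁; proj₂)
open import Relation.Nullary using (does)

-- The alphabet A is Fin m, totally ordered by the natural order of Fin.
Word : ℕ → Set
Word m = List (Fin m)

-- Polynomials of ℤ⟨A⟩ as finite formal sums  Σ c·u  (list of (coefficient, word)).
Poly : ℕ → Set
Poly m = List (ℤ × Word m)

zsum : List ℤ → ℤ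
zsum = foldr ℤ._+_ (+ 0)

coeff : ∀ {m} → Poly m → Word m → ℤ
coeff P u = zsum (map proj₁ (filterᵇ (λ cv → does (≡-dec Fin._≟_ (proj₂ cv) u)) P))

letter : ∀ {m} → Fin m → Poly m
letter a = (ℤ.+ 1 , a ∷ []) ∷ []

pneg : ∀ {m} → Poly m → Poly m
pneg = map (λ cv → (ℤ.- proj₁ cv , proj₂ cv))

pmul : ∀ {m} → Poly m → Poly m → Poly m
pmul P Q = concatMap (λ cu → map (λ dv → (proj₁ cu ℤ.* proj₁ dv , proj₂ cu ++ proj₂ dv)) Q) P

bracket : ∀ {m} → Poly m → Poly m → Poly m
bracket P Q = pmul P Q ++ pneg (pmul Q P)

lnb : ∀ {m} → Word m → Poly m
lnb []      = []
lnb (a ∷ u) = foldl (λ P b → bracket P (letter b)) (letter a) u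

allWords : ∀ {m} → ℕ → List (Word m)
allWords {m} zero    = [] ∷ []
allWords {m} (suc n) = concatMap (λ a → map (a ∷_) (allWords n)) (allFin m)

-- adjoint l* : (l*(u), v) = (l(v), u).  Since l(v) is homogeneous of degree |v|,
-- only words v of length |u| can occur in l*(u).
lstar : ∀ {m} → Word m → Poly m
lstar u = map (λ v → (coeff (lnb v) u , v)) (allWords (length u))

-- Free Lie ring: Lie subring of ℤ⟨A⟩ generated by A, as the image of Lie terms
data LieTerm (m : ℕ) : Set where
  gen  : Fin m → LieTerm m
  zer  : LieTerm m
  add  : LieTerm m → LieTerm m → LieTerm m
  neg  : LieTerm m → LieTerm m
  brk  : LieTerm m → LieTerm m → LieTerm m

evalLie : ∀ {m} → LieTerm m → Poly m
evalLie (gen a)   = letter a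
evalLie zer       = []
evalLie (add s t) = evalLie s ++ evalLie t
evalLie (neg t)   = pneg (evalLie t)
evalLie (brk s t) = bracket (evalLie s) (evalLie t)

ltLex : ∀ {m} → Word m → Word m → Bool
ltLex []      []      = false
ltLex []      (_ ∷ _) = true
ltLex (_ ∷ _) []      = false
ltLex (a ∷ u) (b ∷ v) =
  if toℕ a <ᵇ toℕ b then true else (if toℕ a ≡ᵇ toℕ b then ltLex u v else false)

nonemptySuffixes : ∀ {m} → Word m → List (Word m)
nonemptySuffixes []       = []
nonemptySuffixes (x ∷ xs) = (x ∷ xs) ∷ nonemptySuffixes xs

allB : ∀ {X : Set} → (X → Bool) → List X → Bool
allB p = foldr (λ x b → p x ∧ b) true

isLyndon : ∀ {m} → Word m → Bool
isLyndon []      = false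
isLyndon (a ∷ u) = allB (ltLex (a ∷ u)) (nonemptySuffixes u)

lyndonWords : ∀ {m} → ℕ → List (Word m)
lyndonWords n = filterᵇ isLyndon (allWords n)

-- gcd (in ℕ) of the nonzero integers in a list (gcd of the empty family is 0)
gcdNonzero : List ℤ → ℕ
gcdNonzero zs = foldr gcd 0 (map ∣_∣ (filterᵇ (λ z → 1 ℕ.≤ᵇ ∣ z ∣) zs))

-- A polynomial P is handled through the functional f ↦ ⟪ P , f ⟫ = Σᵤ (P,u) f(u), on which the
-- bracket and the Jacobi identity become identities between iterated sums. By Jacobi every Lie
-- polynomial is a ℤ-combination of left normed brackets l(v), and (l(v), w) = (l*(w), v); so the
-- ideal of w-coefficients of Lie polynomials is generated by the gcd of the coefficients of l*(w).
-- Dually, l*(w) = Σᵢ ξᵢ l*(lᵢ) gives (P, w) = Σᵢ ξᵢ (P, lᵢ) for every Lie polynomial P. For P the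
-- standard bracketing of a Lyndon word lᵢ, which is lᵢ plus lexicographically larger words of the
-- same length, these equations form a unitriangular system, so c(w) divides every ξᵢ; conversely
-- the gcd of the ξᵢ divides every coefficient of l*(w). The second alternative of the theorem thus
-- always holds (for c(w) = 0 both gcds are 0).

module Submission where

open import Defs
open import Data.Bool using (Bool; true; false; T; if_then_else_)
open import Data.Bool.Properties using (T-∧)
open import Data.Empty using (⊥-elim)
open import Data.Fin as Fin using (Fin; toℕ)
import Data.Fin.Properties as Fin
open import Data.Fin.Induction using (>-wellFounded)
open import Data.Integer as ℤ using (ℤ; +_; _+_; _*_; -_; _-_; ∣_∣)
import Data.Integer.Properties as ℤ
import Data.Integer.Divisibility as Unsigned
open import Data.Integer.Divisibility.Signed
  using (_∣_; divides; ∣m∣n⇒∣m+n; ∣m⇒∣-m; ∣m⇒∣m*n; ∣m+n∣m⇒∣n; ∣m+n∣n⇒∣m; ∣ᵤ⇒∣; ∣⇒∣ᵤ)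
open import Data.Integer.Tactic.RingSolver using (solve-∀)
open import Data.List using (List; []; _∷_; _++_; _∷ʳ_; map; length; reverse; foldl; allFin; lookup)
open import Data.List.Properties
  using ( ≡-dec; ++-assoc; ++-identityʳ; ++-conicalˡ; ++-conicalʳ; ∷-injectiveʳ; length-++
        ; length-reverse; reverse-involutive; unfold-reverse; foldl-∷ʳ; map-cong; map-tabulate )
open import Data.List.Relation.Binary.Lex.Strict as Lex using (Lex-<; halt; this; next)
open import Data.List.Relation.Binary.Pointwise using (Pointwise-≡⇒≡; ≡⇒Pointwise-≡)
open import Data.List.Relation.Unary.All as All using (All; []; _∷_)
import Data.List.Relation.Unary.All.Properties as All
open import Data.List.Relation.Unary.AllPairs as AllPairs using (AllPairs; []; _∷_)
import Data.List.Relation.Unary.AllPairs.Properties as AllPairs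
open import Data.List.Relation.Unary.Any using (here; there)
open import Data.List.Relation.Unary.Unique.Propositional using (Unique)
open import Data.List.Membership.Propositional using (_∈_; _∉_)
open import Data.List.Membership.Propositional.Properties using (∈-map⁺; ∈-concat⁺′; ∈-allFin; ∈-lookup)
open import Data.Nat as ℕ using (ℕ; zero; suc; _<_; _≤_; s≤s; _<ᵇ_; _≡ᵇ_; _≤ᵇ_)
import Data.Nat.Properties as ℕ
open import Data.Nat.Induction using (<-wellFounded)
import Data.Nat.Divisibility as ℕ
open import Data.Nat.GCD using (gcd-greatest; gcd[m,n]∣m; gcd[m,n]∣n)
open import Data.Product using (Σ; ∃; ∃₂; _×_; _,_; proj₁; proj₂)
open import Data.Sum using (_⊎_; inj₁; inj₂; [_,_]′)
open import Function using (_∘_; id; _⇔_; Equivalence)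
open import Induction.WellFounded using (Acc; acc)
open import Relation.Nullary using (¬_; does; yes; no)
open import Relation.Binary.Definitions using (Transitive; Decidable; tri<; tri≈; tri>)
open import Relation.Binary.PropositionalEquality
open ≡-Reasoning

private
  variable
    m : ℕ

∣-zsum : {X : Set} {d : ℤ} (g : X → ℤ) (xs : List X) → (∀ j → d ∣ g j) → d ∣ zsum (map g xs)
∣-zsum g [] d∣g = divides (+ 0) refl
∣-zsum g (j ∷ xs) d∣g = ∣m∣n⇒∣m+n (d∣g j) (∣-zsum g xs d∣g)

zsum-allFin-suc : (k : ℕ) (g : Fin (suc k) → ℤ) →
                  zsum (map g (allFin (suc k))) ≡ g Fin.zero + zsum (map (g ∘ Fin.suc) (allFin k))
zsum-allFin-suc k g = cong (λ zs → g Fin.zero + zsum zs)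
  (trans (map-tabulate Fin.suc g) (sym (map-tabulate id (g ∘ Fin.suc))))

∣-isolate : {d : ℤ} {k : ℕ} (g : Fin k → ℤ) (i : Fin k) → d ∣ zsum (map g (allFin k)) →
            (∀ j → j ≢ i → d ∣ g j) → d ∣ g i
∣-isolate {k = suc k} g Fin.zero d∣Σ d∣others =
  ∣m+n∣n⇒∣m (subst (_ ∣_) (zsum-allFin-suc k g) d∣Σ)
            (∣-zsum (g ∘ Fin.suc) (allFin k) (λ j → d∣others (Fin.suc j) (λ ())))
∣-isolate {k = suc k} g (Fin.suc i) d∣Σ d∣others =
  ∣-isolate (g ∘ Fin.suc) i (∣m+n∣m⇒∣n (subst (_ ∣_) (zsum-allFin-suc k g) d∣Σ) (d∣others Fin.zero (λ ())))
            (λ j j≢i → d∣others (Fin.suc j) (j≢i ∘ Fin.suc-injective))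

-- Downward induction on i: in row i the entries left of the diagonal vanish and those to its right
-- multiply coordinates already known to be divisible by d.
∣-unitriangular : {k : ℕ} (d : ℤ) (M : Fin k → Fin k → ℤ) → (∀ i → M i i ≡ + 1) →
                  (∀ {i j} → j Fin.< i → M i j ≡ + 0) → (ξ : Fin k → ℤ) →
                  (∀ i → d ∣ zsum (map (λ j → ξ j * M i j) (allFin k))) → ∀ i → d ∣ ξ i
∣-unitriangular d M diagonal below ξ d∣rows i = go i (>-wellFounded i)
  where
  go : ∀ i → Acc Fin._>_ i → d ∣ ξ i
  go i (acc rec) = subst (d ∣_) (trans (cong (ξ i *_) (diagonal i)) (ℤ.*-identityʳ (ξ i)))
                         (∣-isolate (λ j → ξ j * M i j) i (d∣rows i) d∣others)
    where
    d∣others : ∀ j → j ≢ i → d ∣ ξ j * M i j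
    d∣others j j≢i with Fin.<-cmp j i
    ... | tri< j<i _ _ =
      subst (d ∣_) (sym (trans (cong (ξ j *_) (below j<i)) (ℤ.*-zeroʳ (ξ j)))) (divides (+ 0) refl)
    ... | tri≈ _ j≡i _ = ⊥-elim (j≢i j≡i)
    ... | tri> _ _ i<j = ∣m⇒∣m*n (M i j) (go j (rec i<j))

gcdNonzero-∣ : {X : Set} (f : X → ℤ) {xs : List X} {x : X} → x ∈ xs → + gcdNonzero (map f xs) ∣ f x
gcdNonzero-∣ f x∈xs = ∣ᵤ⇒∣ (go x∈xs)
  where
  1≰ᵇn⇒n≡0 : ∀ n → (1 ≤ᵇ n) ≡ false → n ≡ 0
  1≰ᵇn⇒n≡0 zero _ = refl

  go : ∀ {xs x} → x ∈ xs → gcdNonzero (map f xs) ℕ.∣ ∣ f x ∣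
  go {x′ ∷ xs} x∈ with 1 ≤ᵇ ∣ f x′ ∣ in 1≤ᵇ∣fx′∣ | x∈
  ... | true  | here refl = gcd[m,n]∣m ∣ f x′ ∣ _
  ... | true  | there x∈xs = ℕ.∣-trans (gcd[m,n]∣n ∣ f x′ ∣ _) (go x∈xs)
  ... | false | here refl = subst (_ ℕ.∣_) (sym (1≰ᵇn⇒n≡0 _ 1≤ᵇ∣fx′∣)) (_ ℕ.∣0)
  ... | false | there x∈xs = go x∈xs

∣-gcdNonzero : {X : Set} {d : ℕ} (f : X → ℤ) (xs : List X) → (∀ x → + d ∣ f x) → d ℕ.∣ gcdNonzero (map f xs)
∣-gcdNonzero f [] d∣f = _ ℕ.∣0
∣-gcdNonzero f (x ∷ xs) d∣f with 1 ≤ᵇ ∣ f x ∣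
... | true = gcd-greatest (∣⇒∣ᵤ (d∣f x)) (∣-gcdNonzero f xs d∣f)
... | false = ∣-gcdNonzero f xs d∣f

∃-minimal : {A : Set} {_<_ : A → A → Set} → (∀ {a} → ¬ a < a) → Transitive _<_ → Decidable _<_ →
            (x : A) (xs : List A) → ∃ λ s → s ∈ x ∷ xs × (∀ {s′} → s′ ∈ x ∷ xs → ¬ s′ < s)
∃-minimal irrefl <-trans _<?_ x [] = x , here refl , λ { (here refl) → irrefl }
∃-minimal irrefl <-trans _<?_ x (y ∷ ys) with ∃-minimal irrefl <-trans _<?_ y ys
... | s , s∈ , s-min with x <? s
...   | yes x<s = x , here refl , λ { (here refl) → irrefl ; (there s′∈) s′<x → s-min s′∈ (<-trans s′<x x<s) }
...   | no x≮s = s , there s∈ , λ { (here refl) → x≮s ; (there s′∈) → s-min s′∈ }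

AllPairs-lookup : {A : Set} {R : A → A → Set} {xs : List A} → AllPairs R xs →
                  ∀ {i j} → i Fin.< j → R (lookup xs i) (lookup xs j)
AllPairs-lookup (Rx ∷ _) {Fin.zero} {Fin.suc j} _ = All.lookup Rx (∈-lookup j)
AllPairs-lookup (_ ∷ sorted) {Fin.suc i} {Fin.suc j} (s≤s i<j) = AllPairs-lookup sorted i<j

allB⇒All : {X : Set} (p : X → Bool) (xs : List X) → T (allB p xs) → All (T ∘ p) xs
allB⇒All p [] _ = []
allB⇒All p (x ∷ xs) h = proj₁ px∧ps ∷ allB⇒All p xs (proj₂ px∧ps)
  where
  px∧ps : T (p x) × T (allB p xs)
  px∧ps = Equivalence.to T-∧ h

-- Pairing polynomials with functions on words

infix 4 _≈_
infixr 5 _⊳_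

⟪_,_⟫ : Poly m → (Word m → ℤ) → ℤ
⟪ [] , f ⟫ = + 0
⟪ (c , x) ∷ P , f ⟫ = c * f x + ⟪ P , f ⟫

_⊳_ : Poly m → (Word m → ℤ) → Word m → ℤ
(Q ⊳ f) x = ⟪ Q , (λ y → f (x ++ y)) ⟫

⟪⟫-++ : (P Q : Poly m) (f : Word m → ℤ) → ⟪ P ++ Q , f ⟫ ≡ ⟪ P , f ⟫ + ⟪ Q , f ⟫
⟪⟫-++ [] Q f = sym (ℤ.+-identityˡ _)
⟪⟫-++ ((c , x) ∷ P) Q f =
  trans (cong (λ p → c * f x + p) (⟪⟫-++ P Q f)) (sym (ℤ.+-assoc (c * f x) ⟪ P , f ⟫ ⟪ Q , f ⟫))

⟪⟫-pneg : (P : Poly m) (f : Word m → ℤ) → ⟪ pneg P , f ⟫ ≡ - ⟪ P , f ⟫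
⟪⟫-pneg [] f = refl
⟪⟫-pneg ((c , x) ∷ P) f = trans (cong (λ p → (- c) * f x + p) (⟪⟫-pneg P f)) (ring c (f x) ⟪ P , f ⟫)
  where
  ring : ∀ c a p → (- c) * a + - p ≡ - (c * a + p)
  ring = solve-∀

⟪⟫-cong : (P : Poly m) {f g : Word m → ℤ} → (∀ x → f x ≡ g x) → ⟪ P , f ⟫ ≡ ⟪ P , g ⟫
⟪⟫-cong [] f≗g = refl
⟪⟫-cong ((c , x) ∷ P) f≗g = cong₂ (λ a p → c * a + p) (f≗g x) (⟪⟫-cong P f≗g)

⟪⟫-zero : (P : Poly m) → ⟪ P , (λ _ → + 0) ⟫ ≡ + 0
⟪⟫-zero [] = refl
⟪⟫-zero ((c , x) ∷ P) = trans (cong (λ p → c * + 0 + p) (⟪⟫-zero P)) (trans (ℤ.+-identityʳ _) (ℤ.*-zeroʳ c))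

⟪⟫-+ : (P : Poly m) (f g : Word m → ℤ) → ⟪ P , (λ x → f x + g x) ⟫ ≡ ⟪ P , f ⟫ + ⟪ P , g ⟫
⟪⟫-+ [] f g = refl
⟪⟫-+ ((c , x) ∷ P) f g = trans (cong (λ p → c * (f x + g x) + p) (⟪⟫-+ P f g)) (ring c (f x) (g x) _ _)
  where
  ring : ∀ c a b p q → c * (a + b) + (p + q) ≡ (c * a + p) + (c * b + q)
  ring = solve-∀

⟪⟫-neg : (P : Poly m) (f : Word m → ℤ) → ⟪ P , (λ x → - f x) ⟫ ≡ - ⟪ P , f ⟫
⟪⟫-neg [] f = refl
⟪⟫-neg ((c , x) ∷ P) f = trans (cong (λ p → c * - f x + p) (⟪⟫-neg P f)) (ring c (f x) _)
  where
  ring : ∀ c a p → c * - a + - p ≡ - (c * a + p)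
  ring = solve-∀

⟪⟫-- : (P : Poly m) (f g : Word m → ℤ) → ⟪ P , (λ x → f x - g x) ⟫ ≡ ⟪ P , f ⟫ - ⟪ P , g ⟫
⟪⟫-- P f g = trans (⟪⟫-+ P f (λ x → - g x)) (cong (λ p → ⟪ P , f ⟫ + p) (⟪⟫-neg P g))

⟪⟫-* : (P : Poly m) (a : ℤ) (f : Word m → ℤ) → ⟪ P , (λ x → a * f x) ⟫ ≡ a * ⟪ P , f ⟫
⟪⟫-* [] a f = sym (ℤ.*-zeroʳ a)
⟪⟫-* ((c , x) ∷ P) a f = trans (cong (λ p → c * (a * f x) + p) (⟪⟫-* P a f)) (ring c a (f x) _)
  where
  ring : ∀ c a b p → c * (a * b) + a * p ≡ a * (c * b + p)
  ring = solve-∀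

⟪⟫-zsum : {X : Set} (P : Poly m) (xs : List X) (g : X → Word m → ℤ) →
          ⟪ P , (λ x → zsum (map (λ j → g j x) xs)) ⟫ ≡ zsum (map (λ j → ⟪ P , g j ⟫) xs)
⟪⟫-zsum P [] g = ⟪⟫-zero P
⟪⟫-zsum P (j ∷ xs) g = trans (⟪⟫-+ P (g j) _) (cong (λ p → ⟪ P , g j ⟫ + p) (⟪⟫-zsum P xs g))

⟪⟫-pmul : (P Q : Poly m) (f : Word m → ℤ) → ⟪ pmul P Q , f ⟫ ≡ ⟪ P , Q ⊳ f ⟫
⟪⟫-pmul [] Q f = refl
⟪⟫-pmul ((c , u) ∷ P) Q f = begin
  ⟪ map (λ dv → (c * proj₁ dv , u ++ proj₂ dv)) Q ++ pmul P Q , f ⟫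
    ≡⟨ ⟪⟫-++ (map (λ dv → (c * proj₁ dv , u ++ proj₂ dv)) Q) (pmul P Q) f ⟩
  ⟪ map (λ dv → (c * proj₁ dv , u ++ proj₂ dv)) Q , f ⟫ + ⟪ pmul P Q , f ⟫
    ≡⟨ cong₂ _+_ (scaled-shift Q) (⟪⟫-pmul P Q f) ⟩
  c * (Q ⊳ f) u + ⟪ P , Q ⊳ f ⟫ ∎
  where
  scaled-shift : ∀ R → ⟪ map (λ dv → (c * proj₁ dv , u ++ proj₂ dv)) R , f ⟫ ≡ c * (R ⊳ f) u
  scaled-shift [] = sym (ℤ.*-zeroʳ c)
  scaled-shift ((d , v) ∷ R) = trans (cong (λ p → c * d * f (u ++ v) + p) (scaled-shift R)) (ring c d _ _)
    where
    ring : ∀ c d a p → c * d * a + c * p ≡ c * (d * a + p)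
    ring = solve-∀

⟪⟫-bracket-pmul : (P Q : Poly m) (f : Word m → ℤ) →
                  ⟪ bracket P Q , f ⟫ ≡ ⟪ pmul P Q , f ⟫ - ⟪ pmul Q P , f ⟫
⟪⟫-bracket-pmul P Q f = trans (⟪⟫-++ (pmul P Q) (pneg (pmul Q P)) f)
                              (cong (λ p → ⟪ pmul P Q , f ⟫ + p) (⟪⟫-pneg (pmul Q P) f))

⟪⟫-bracket : (P Q : Poly m) (f : Word m → ℤ) → ⟪ bracket P Q , f ⟫ ≡ ⟪ P , Q ⊳ f ⟫ - ⟪ Q , P ⊳ f ⟫
⟪⟫-bracket P Q f = trans (⟪⟫-bracket-pmul P Q f) (cong₂ _-_ (⟪⟫-pmul P Q f) (⟪⟫-pmul Q P f))

⊳-bracket : (P Q : Poly m) (f : Word m → ℤ) (x : Word m) →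
            (bracket P Q ⊳ f) x ≡ (P ⊳ Q ⊳ f) x - (Q ⊳ P ⊳ f) x
⊳-bracket P Q f x = trans (⟪⟫-bracket P Q (λ y → f (x ++ y))) (cong₂ _-_ (reassoc P Q) (reassoc Q P))
  where
  reassoc : ∀ R S → ⟪ R , S ⊳ (λ y → f (x ++ y)) ⟫ ≡ (R ⊳ S ⊳ f) x
  reassoc R S = ⟪⟫-cong R (λ y → ⟪⟫-cong S (λ z → cong f (sym (++-assoc x y z))))

⟪⟫-⊳-bracket : (R P Q : Poly m) (f : Word m → ℤ) →
               ⟪ R , bracket P Q ⊳ f ⟫ ≡ ⟪ R , P ⊳ Q ⊳ f ⟫ - ⟪ R , Q ⊳ P ⊳ f ⟫
⟪⟫-⊳-bracket R P Q f = trans (⟪⟫-cong R (⊳-bracket P Q f)) (⟪⟫-- R (P ⊳ Q ⊳ f) (Q ⊳ P ⊳ f))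

record _≈_ (P Q : Poly m) : Set where
  constructor mk≈
  field same-pairing : ∀ f → ⟪ P , f ⟫ ≡ ⟪ Q , f ⟫
open _≈_

≈-sym : {P Q : Poly m} → P ≈ Q → Q ≈ P
≈-sym (mk≈ eq) = mk≈ (λ f → sym (eq f))

bracket-[]ˡ : (Q : Poly m) → bracket [] Q ≈ []
bracket-[]ˡ Q = mk≈ λ f → trans (⟪⟫-bracket [] Q f) (cong (λ p → + 0 - p) (⟪⟫-zero Q))

bracket-++ˡ : (P P′ Q : Poly m) → bracket (P ++ P′) Q ≈ bracket P Q ++ bracket P′ Q
bracket-++ˡ P P′ Q = mk≈ λ f → begin
  ⟪ bracket (P ++ P′) Q , f ⟫
    ≡⟨ ⟪⟫-bracket (P ++ P′) Q f ⟩
  ⟪ P ++ P′ , Q ⊳ f ⟫ - ⟪ Q , (P ++ P′) ⊳ f ⟫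
    ≡⟨ cong₂ _-_ (⟪⟫-++ P P′ (Q ⊳ f))
                 (trans (⟪⟫-cong Q (λ x → ⟪⟫-++ P P′ _)) (⟪⟫-+ Q (P ⊳ f) (P′ ⊳ f))) ⟩
  (⟪ P , Q ⊳ f ⟫ + ⟪ P′ , Q ⊳ f ⟫) - (⟪ Q , P ⊳ f ⟫ + ⟪ Q , P′ ⊳ f ⟫)
    ≡⟨ interchange ⟪ P , Q ⊳ f ⟫ ⟪ P′ , Q ⊳ f ⟫ ⟪ Q , P ⊳ f ⟫ ⟪ Q , P′ ⊳ f ⟫ ⟩
  (⟪ P , Q ⊳ f ⟫ - ⟪ Q , P ⊳ f ⟫) + (⟪ P′ , Q ⊳ f ⟫ - ⟪ Q , P′ ⊳ f ⟫)
    ≡⟨ sym (cong₂ _+_ (⟪⟫-bracket P Q f) (⟪⟫-bracket P′ Q f)) ⟩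
  ⟪ bracket P Q , f ⟫ + ⟪ bracket P′ Q , f ⟫
    ≡⟨ sym (⟪⟫-++ (bracket P Q) (bracket P′ Q) f) ⟩
  ⟪ bracket P Q ++ bracket P′ Q , f ⟫ ∎
  where
  interchange : ∀ a b c d → (a + b) - (c + d) ≡ (a - c) + (b - d)
  interchange = solve-∀

bracket-pnegˡ : (P Q : Poly m) → bracket (pneg P) Q ≈ pneg (bracket P Q)
bracket-pnegˡ P Q = mk≈ λ f → begin
  ⟪ bracket (pneg P) Q , f ⟫
    ≡⟨ ⟪⟫-bracket (pneg P) Q f ⟩
  ⟪ pneg P , Q ⊳ f ⟫ - ⟪ Q , pneg P ⊳ f ⟫
    ≡⟨ cong₂ _-_ (⟪⟫-pneg P (Q ⊳ f)) (⟪⟫-cong Q (λ x → ⟪⟫-pneg P _)) ⟩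
  - ⟪ P , Q ⊳ f ⟫ - ⟪ Q , (λ x → - (P ⊳ f) x) ⟫
    ≡⟨ cong (λ p → - ⟪ P , Q ⊳ f ⟫ - p) (⟪⟫-neg Q (P ⊳ f)) ⟩
  - ⟪ P , Q ⊳ f ⟫ - - ⟪ Q , P ⊳ f ⟫
    ≡⟨ neg-distrib ⟪ P , Q ⊳ f ⟫ ⟪ Q , P ⊳ f ⟫ ⟩
  - (⟪ P , Q ⊳ f ⟫ - ⟪ Q , P ⊳ f ⟫)
    ≡⟨ cong -_ (sym (⟪⟫-bracket P Q f)) ⟩
  - ⟪ bracket P Q , f ⟫
    ≡⟨ sym (⟪⟫-pneg (bracket P Q) f) ⟩
  ⟪ pneg (bracket P Q) , f ⟫ ∎
  where
  neg-distrib : ∀ a b → - a - - b ≡ - (a - b)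
  neg-distrib = solve-∀

bracket-congˡ : {P P′ : Poly m} (Q : Poly m) → P ≈ P′ → bracket P Q ≈ bracket P′ Q
bracket-congˡ {P = P} {P′} Q (mk≈ eq) = mk≈ λ f → begin
  ⟪ bracket P Q , f ⟫            ≡⟨ ⟪⟫-bracket P Q f ⟩
  ⟪ P , Q ⊳ f ⟫ - ⟪ Q , P ⊳ f ⟫   ≡⟨ cong₂ _-_ (eq (Q ⊳ f)) (⟪⟫-cong Q (λ x → eq _)) ⟩
  ⟪ P′ , Q ⊳ f ⟫ - ⟪ Q , P′ ⊳ f ⟫ ≡⟨ sym (⟪⟫-bracket P′ Q f) ⟩
  ⟪ bracket P′ Q , f ⟫ ∎

bracket-antisym : (P Q : Poly m) → bracket P Q ≈ pneg (bracket Q P)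
bracket-antisym P Q = mk≈ λ f → begin
  ⟪ bracket P Q , f ⟫             ≡⟨ ⟪⟫-bracket P Q f ⟩
  ⟪ P , Q ⊳ f ⟫ - ⟪ Q , P ⊳ f ⟫    ≡⟨ swap ⟪ P , Q ⊳ f ⟫ ⟪ Q , P ⊳ f ⟫ ⟩
  - (⟪ Q , P ⊳ f ⟫ - ⟪ P , Q ⊳ f ⟫) ≡⟨ cong -_ (sym (⟪⟫-bracket Q P f)) ⟩
  - ⟪ bracket Q P , f ⟫           ≡⟨ sym (⟪⟫-pneg (bracket Q P) f) ⟩
  ⟪ pneg (bracket Q P) , f ⟫ ∎
  where
  swap : ∀ a b → a - b ≡ - (b - a)
  swap = solve-∀

jacobi : (X Y Z : Poly m) →
         bracket X (bracket Y Z) ≈ bracket (bracket X Y) Z ++ pneg (bracket (bracket X Z) Y)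
jacobi X Y Z = mk≈ λ f → begin
  ⟪ bracket X (bracket Y Z) , f ⟫
    ≡⟨ expandʳ f ⟩
  (t X Y Z f - t X Z Y f) - (t Y Z X f - t Z Y X f)
    ≡⟨ regroup (t X Y Z f) (t X Z Y f) (t Y Z X f) (t Z Y X f) (t Y X Z f) (t Z X Y f) ⟩
  ((t X Y Z f - t Y X Z f) - (t Z X Y f - t Z Y X f))
    + - ((t X Z Y f - t Z X Y f) - (t Y X Z f - t Y Z X f))
    ≡⟨ sym (cong₂ (λ a b → a + - b) (expandˡ X Y Z f) (expandˡ X Z Y f)) ⟩
  ⟪ bracket (bracket X Y) Z , f ⟫ + - ⟪ bracket (bracket X Z) Y , f ⟫
    ≡⟨ sym (trans (⟪⟫-++ (bracket (bracket X Y) Z) _ f)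
                  (cong (λ p → ⟪ bracket (bracket X Y) Z , f ⟫ + p) (⟪⟫-pneg (bracket (bracket X Z) Y) f))) ⟩
  ⟪ bracket (bracket X Y) Z ++ pneg (bracket (bracket X Z) Y) , f ⟫ ∎
  where
  t : Poly m → Poly m → Poly m → (Word m → ℤ) → ℤ
  t A B C f = ⟪ A , B ⊳ C ⊳ f ⟫

  expandˡ : ∀ A B C f → ⟪ bracket (bracket A B) C , f ⟫ ≡ (t A B C f - t B A C f) - (t C A B f - t C B A f)
  expandˡ A B C f = trans (⟪⟫-bracket (bracket A B) C f)
                          (cong₂ _-_ (⟪⟫-bracket A B (C ⊳ f)) (⟪⟫-⊳-bracket C A B f))

  expandʳ : ∀ f → ⟪ bracket X (bracket Y Z) , f ⟫ ≡ (t X Y Z f - t X Z Y f) - (t Y Z X f - t Z Y X f)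
  expandʳ f = trans (⟪⟫-bracket X (bracket Y Z) f)
                    (cong₂ _-_ (⟪⟫-⊳-bracket X Y Z f) (⟪⟫-bracket Y Z (X ⊳ f)))

  regroup : ∀ a b c d e g → (a - b) - (c - d) ≡ ((a - e) - (g - d)) + - ((b - g) - (e - c))
  regroup = solve-∀

-- The span of left normed brackets

leftNormed : Fin m → Word m → Poly m
leftNormed b [] = letter b
leftNormed b (a ∷ r) = bracket (leftNormed b r) (letter a)

data Span {m : ℕ} : Poly m → Set where
  span-gen  : ∀ b r → Span (leftNormed b r)
  span-[]   : Span []
  span-++   : ∀ {P Q} → Span P → Span Q → Span (P ++ Q)
  span-pneg : ∀ {P} → Span P → Span (pneg P)
  span-≈    : ∀ {P Q} → P ≈ Q → Span P → Span Q

span-bracketˡ : {Q : Poly m} → (∀ b r → Span (bracket (leftNormed b r) Q)) →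
                {P : Poly m} → Span P → Span (bracket P Q)
span-bracketˡ on-gen (span-gen b r) = on-gen b r
span-bracketˡ {Q = Q} on-gen span-[] = span-≈ (≈-sym (bracket-[]ˡ Q)) span-[]
span-bracketˡ {Q = Q} on-gen (span-++ {P} {P′} s s′) =
  span-≈ (≈-sym (bracket-++ˡ P P′ Q)) (span-++ (span-bracketˡ on-gen s) (span-bracketˡ on-gen s′))
span-bracketˡ {Q = Q} on-gen (span-pneg {P} s) =
  span-≈ (≈-sym (bracket-pnegˡ P Q)) (span-pneg (span-bracketˡ on-gen s))
span-bracketˡ {Q = Q} on-gen (span-≈ P≈P′ s) = span-≈ (bracket-congˡ Q P≈P′) (span-bracketˡ on-gen s)

span-bracket-letter : (a : Fin m) {P : Poly m} → Span P → Span (bracket P (letter a))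
span-bracket-letter a = span-bracketˡ (λ b r → span-gen b (a ∷ r))

span-bracket-leftNormed : (b : Fin m) (r : Word m) (b′ : Fin m) (r′ : Word m) →
                          Span (bracket (leftNormed b r) (leftNormed b′ r′))
span-bracket-leftNormed b r b′ [] = span-gen b (b′ ∷ r)
span-bracket-leftNormed b r b′ (a ∷ r′) =
  span-≈ (≈-sym (jacobi (leftNormed b r) (leftNormed b′ r′) (letter a)))
    (span-++ (span-bracket-letter a (span-bracket-leftNormed b r b′ r′))
             (span-pneg (span-bracket-leftNormed b (a ∷ r) b′ r′)))

span-bracket : {P Q : Poly m} → Span P → Span Q → Span (bracket P Q)
span-bracket {Q = Q} sP sQ = span-bracketˡ on-gen sP
  where
  on-gen : ∀ b r → Span (bracket (leftNormed b r) Q)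
  on-gen b r = span-≈ (≈-sym (bracket-antisym (leftNormed b r) Q))
                      (span-pneg (span-bracketˡ (λ b′ r′ → span-bracket-leftNormed b′ r′ b r) sQ))

span-evalLie : (t : LieTerm m) → Span (evalLie t)
span-evalLie (gen a) = span-gen a []
span-evalLie zer = span-[]
span-evalLie (add s t) = span-++ (span-evalLie s) (span-evalLie t)
span-evalLie (neg t) = span-pneg (span-evalLie t)
span-evalLie (brk s t) = span-bracket (span-evalLie s) (span-evalLie t)

module _ (S : ℤ → Set) (S-0 : S (+ 0)) (S-+ : ∀ {a b} → S a → S b → S (a + b))
         (S-neg : ∀ {a} → S a → S (- a)) where

  span-pairing : (f : Word m → ℤ) → (∀ b r → S ⟪ leftNormed b r , f ⟫) →
                 {P : Poly m} → Span P → S ⟪ P , f ⟫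
  span-pairing f on-gen (span-gen b r) = on-gen b r
  span-pairing f on-gen span-[] = S-0
  span-pairing f on-gen (span-++ {P} {Q} s t) =
    subst S (sym (⟪⟫-++ P Q f)) (S-+ (span-pairing f on-gen s) (span-pairing f on-gen t))
  span-pairing f on-gen (span-pneg {P} s) = subst S (sym (⟪⟫-pneg P f)) (S-neg (span-pairing f on-gen s))
  span-pairing f on-gen (span-≈ P≈Q s) = subst S (same-pairing P≈Q f) (span-pairing f on-gen s)

span-⟪⟫-cong : {f g : Word m → ℤ} → (∀ b r → ⟪ leftNormed b r , f ⟫ ≡ ⟪ leftNormed b r , g ⟫) →
               {P : Poly m} → Span P → ⟪ P , f ⟫ ≡ ⟪ P , g ⟫
span-⟪⟫-cong {f = f} {g} on-gen {P} P∈span = ℤ.i-j≡0⇒i≡j ⟪ P , f ⟫ ⟪ P , g ⟫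
  (trans (sym (⟪⟫-- P f g))
         (span-pairing (_≡ + 0) refl (cong₂ _+_) (cong (-_)) _
                       (λ b r → trans (⟪⟫-- (leftNormed b r) f g) (ℤ.i≡j⇒i-j≡0 (on-gen b r))) P∈span))

δ : Word m → Word m → ℤ
δ u x = if does (≡-dec Fin._≟_ x u) then + 1 else + 0

δ-self : (u : Word m) → δ u u ≡ + 1
δ-self u with ≡-dec Fin._≟_ u u
... | yes _ = refl
... | no u≢u = ⊥-elim (u≢u refl)

δ-≢ : {u x : Word m} → x ≢ u → δ u x ≡ + 0
δ-≢ {u = u} {x} x≢u with ≡-dec Fin._≟_ x u
... | yes x≡u = ⊥-elim (x≢u x≡u)
... | no _ = refl

coeff-⟪⟫ : (P : Poly m) (u : Word m) → coeff P u ≡ ⟪ P , δ u ⟫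
coeff-⟪⟫ [] u = refl
coeff-⟪⟫ ((c , x) ∷ P) u with does (≡-dec Fin._≟_ x u)
... | true = cong₂ _+_ (sym (ℤ.*-identityʳ c)) (coeff-⟪⟫ P u)
... | false = trans (coeff-⟪⟫ P u) (sym (trans (cong (_+ ⟪ P , δ u ⟫) (ℤ.*-zeroʳ c)) (ℤ.+-identityˡ _)))

formalSum : (Word m → ℤ) → List (Word m) → Poly m
formalSum h = map (λ v → (h v , v))

coeff-formalSum-∉ : (h : Word m → ℤ) (L : List (Word m)) {u : Word m} → u ∉ L →
                    coeff (formalSum h L) u ≡ + 0
coeff-formalSum-∉ h L {u} u∉L = trans (coeff-⟪⟫ (formalSum h L) u) (go L u∉L)
  where
  go : ∀ L → u ∉ L → ⟪ formalSum h L , δ u ⟫ ≡ + 0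
  go [] _ = refl
  go (v ∷ L) u∉v∷L = trans (cong₂ (λ a p → h v * a + p) (δ-≢ (u∉v∷L ∘ here ∘ sym)) (go L (u∉v∷L ∘ there)))
                           (trans (ℤ.+-identityʳ _) (ℤ.*-zeroʳ (h v)))

coeff-formalSum-∈ : (h : Word m → ℤ) {L : List (Word m)} {u : Word m} → Unique L → u ∈ L →
                    coeff (formalSum h L) u ≡ h u
coeff-formalSum-∈ h {L} {u} L-unique u∈L = trans (coeff-⟪⟫ (formalSum h L) u) (go L-unique u∈L)
  where
  go : ∀ {L} → Unique L → u ∈ L → ⟪ formalSum h L , δ u ⟫ ≡ h u
  go {_ ∷ L} (u∉L ∷ _) (here refl) =
    trans (cong₂ (λ a p → h u * a + p) (δ-self u) absent) (trans (ℤ.+-identityʳ _) (ℤ.*-identityʳ (h u)))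
    where
    absent : ⟪ formalSum h L , δ u ⟫ ≡ + 0
    absent = trans (sym (coeff-⟪⟫ (formalSum h L) u)) (coeff-formalSum-∉ h L (All.All¬⇒¬Any u∉L))
  go {v ∷ L} (v∉L ∷ L-unique) (there u∈L) =
    trans (cong₂ (λ a p → h v * a + p) (δ-≢ (All.lookup v∉L u∈L)) (go L-unique u∈L))
          (trans (cong (_+ h u) (ℤ.*-zeroʳ (h v))) (ℤ.+-identityˡ (h u)))

∣-coeff-formalSum : {d : ℤ} (h : Word m → ℤ) (L : List (Word m)) → (∀ {v} → v ∈ L → d ∣ h v) →
                    ∀ u → d ∣ coeff (formalSum h L) u
∣-coeff-formalSum {d = d} h L d∣h u = subst (d ∣_) (sym (coeff-⟪⟫ (formalSum h L) u)) (go L d∣h)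
  where
  go : ∀ L → (∀ {v} → v ∈ L → d ∣ h v) → d ∣ ⟪ formalSum h L , δ u ⟫
  go [] _ = divides (+ 0) refl
  go (v ∷ L) d∣h = ∣m∣n⇒∣m+n (∣m⇒∣m*n (δ u v) (d∣h (here refl))) (go L (d∣h ∘ there))

-- Lexicographic order and Lyndon words

infix 4 _<ₗ_

_<ₗ_ : Word m → Word m → Set
_<ₗ_ = Lex-< _≡_ Fin._<_

<ₗ-trans : Transitive (_<ₗ_ {m})
<ₗ-trans = Lex.<-transitive isEquivalence Fin.<-resp₂-≡ Fin.<-trans

<ₗ-irrefl : (x : Word m) → ¬ x <ₗ x
<ₗ-irrefl x = Lex.<-irreflexive Fin.<-irrefl (≡⇒Pointwise-≡ refl)

<ₗ⇒≢ : {x y : Word m} → x <ₗ y → x ≢ y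
<ₗ⇒≢ x<x refl = <ₗ-irrefl _ x<x

<ₗ-cmp : (x y : Word m) → x <ₗ y ⊎ x ≡ y ⊎ y <ₗ x
<ₗ-cmp x y with Lex.<-compare sym Fin.<-cmp x y
... | tri< x<y _ _ = inj₁ x<y
... | tri≈ _ x≋y _ = inj₂ (inj₁ (Pointwise-≡⇒≡ x≋y))
... | tri> _ _ y<x = inj₂ (inj₂ y<x)

_<ₗ?_ : Decidable (_<ₗ_ {m})
_<ₗ?_ = Lex.<-decidable Fin._≟_ Fin._<?_

ltLex⇒<ₗ : (x y : Word m) → T (ltLex x y) → x <ₗ y
ltLex⇒<ₗ [] (b ∷ y) _ = halt
ltLex⇒<ₗ (a ∷ x) (b ∷ y) h with toℕ a <ᵇ toℕ b in a<ᵇb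
... | true = this (ℕ.<ᵇ⇒< (toℕ a) (toℕ b) (subst T (sym a<ᵇb) _))
... | false with toℕ a ≡ᵇ toℕ b in a≡ᵇb
... | true = next (Fin.toℕ-injective (ℕ.≡ᵇ⇒≡ (toℕ a) (toℕ b) (subst T (sym a≡ᵇb) _))) (ltLex⇒<ₗ x y h)

<ₗ-prefix⁺ : (z : Word m) {y y′ : Word m} → y <ₗ y′ → z ++ y <ₗ z ++ y′
<ₗ-prefix⁺ [] y<y′ = y<y′
<ₗ-prefix⁺ (a ∷ z) y<y′ = next refl (<ₗ-prefix⁺ z y<y′)

<ₗ-prefix⁻ : (z : Word m) {y y′ : Word m} → z ++ y <ₗ z ++ y′ → y <ₗ y′
<ₗ-prefix⁻ [] y<y′ = y<y′
<ₗ-prefix⁻ (a ∷ z) (this a<a) = ⊥-elim (Fin.<-irrefl refl a<a)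
<ₗ-prefix⁻ (a ∷ z) (next _ zy<zy′) = <ₗ-prefix⁻ z zy<zy′

-- The length condition excludes x being a proper prefix of y, the only way appending could break x <ₗ y.
<ₗ-++ : {x y : Word m} (z z′ : Word m) → x <ₗ y → length y ≤ length x → x ++ z <ₗ y ++ z′
<ₗ-++ z z′ (this a<b) _ = this a<b
<ₗ-++ z z′ (next refl x<y) (s≤s |y|≤|x|) = next refl (<ₗ-++ z z′ x<y |y|≤|x|)

<ₗ-++⁻ : (x y : Word m) {z z′ : Word m} → x ++ z <ₗ y ++ z′ → length y ≤ length x →
         (∃ λ t → x ≡ y ++ t) ⊎ x <ₗ y
<ₗ-++⁻ x [] _ _ = inj₁ (x , refl)
<ₗ-++⁻ (a ∷ x) (b ∷ y) (this a<b) _ = inj₂ (this a<b)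
<ₗ-++⁻ (a ∷ x) (.a ∷ y) (next refl xz<yz′) (s≤s |y|≤|x|) with <ₗ-++⁻ x y xz<yz′ |y|≤|x|
... | inj₁ (t , refl) = inj₁ (t , refl)
... | inj₂ x<y = inj₂ (next refl x<y)

∈-nonemptySuffixes : (q : Word m) {s : Word m} → s ≢ [] → s ∈ nonemptySuffixes (q ++ s)
∈-nonemptySuffixes [] {[]} s≢[] = ⊥-elim (s≢[] refl)
∈-nonemptySuffixes [] {_ ∷ _} _ = here refl
∈-nonemptySuffixes (a ∷ q) s≢[] = there (∈-nonemptySuffixes q s≢[])

nonemptySuffixes-∈ : {u s : Word m} → s ∈ nonemptySuffixes u → s ≢ [] × ∃ λ q → u ≡ q ++ s
nonemptySuffixes-∈ {u = a ∷ u} (here refl) = (λ ()) , [] , refl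
nonemptySuffixes-∈ {u = a ∷ u} (there s∈) with nonemptySuffixes-∈ s∈
... | s≢[] , q , u≡q++s = s≢[] , a ∷ q , cong (a ∷_) u≡q++s

length-proper-suffix : (p s : Word m) → p ≢ [] → length s < length (p ++ s)
length-proper-suffix [] s p≢[] = ⊥-elim (p≢[] refl)
length-proper-suffix (a ∷ p) s _ =
  s≤s (subst (length s ≤_) (sym (length-++ p)) (ℕ.m≤n+m (length s) (length p)))

length-proper-prefix : (p s : Word m) → s ≢ [] → length p < length (p ++ s)
length-proper-prefix p [] s≢[] = ⊥-elim (s≢[] refl)
length-proper-prefix p (a ∷ s) _ =
  subst (length p <_) (sym (length-++ p)) (ℕ.m<m+n (length p) (s≤s ℕ.z≤n))

record IsLyndon (l : Word m) : Set where
  field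
    nonempty : l ≢ []
    <ₗ-proper-suffix : ∀ p s → p ≢ [] → s ≢ [] → l ≡ p ++ s → l <ₗ s

isLyndon⇒IsLyndon : (l : Word m) → T (isLyndon l) → IsLyndon l
isLyndon⇒IsLyndon (a ∷ u) h = record { nonempty = λ () ; <ₗ-proper-suffix = smaller-than-suffix }
  where
  smaller-than-suffix : ∀ p s → p ≢ [] → s ≢ [] → a ∷ u ≡ p ++ s → a ∷ u <ₗ s
  smaller-than-suffix [] s p≢[] _ _ = ⊥-elim (p≢[] refl)
  smaller-than-suffix (.a ∷ p) s _ s≢[] refl =
    ltLex⇒<ₗ _ s (All.lookup (allB⇒All _ _ h) (∈-nonemptySuffixes p s≢[]))

-- The standard factorisation: l₂ is the lexicographically smallest proper suffix.
standard-factorisation : (a b : Fin m) (u : Word m) → IsLyndon (a ∷ b ∷ u) →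
                         ∃₂ λ l₁ l₂ → IsLyndon l₁ × IsLyndon l₂ × a ∷ b ∷ u ≡ l₁ ++ l₂
standard-factorisation a b u lyn
  with ∃-minimal (<ₗ-irrefl _) <ₗ-trans _<ₗ?_ (b ∷ u) (nonemptySuffixes u)
... | l₂ , l₂∈ , l₂-min with nonemptySuffixes-∈ l₂∈
... | l₂≢[] , q , b∷u≡q++l₂ = a ∷ q , l₂ , l₁-lyndon , l₂-lyndon , l≡l₁++l₂
  where
  open IsLyndon lyn

  l≡l₁++l₂ : a ∷ b ∷ u ≡ (a ∷ q) ++ l₂
  l≡l₁++l₂ = cong (a ∷_) b∷u≡q++l₂

  not-below-l₂ : ∀ p {s} → p ≢ [] → a ∷ b ∷ u ≡ p ++ s → s ≢ [] → ¬ s <ₗ l₂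
  not-below-l₂ [] p≢[] = ⊥-elim (p≢[] refl)
  not-below-l₂ (_ ∷ p) _ l≡p++s s≢[] =
    l₂-min (subst (λ v → _ ∈ nonemptySuffixes v) (sym (∷-injectiveʳ l≡p++s)) (∈-nonemptySuffixes p s≢[]))

  l₂-lyndon : IsLyndon l₂
  l₂-lyndon = record { nonempty = l₂≢[] ; <ₗ-proper-suffix = smaller-than-suffix }
    where
    smaller-than-suffix : ∀ p s → p ≢ [] → s ≢ [] → l₂ ≡ p ++ s → l₂ <ₗ s
    smaller-than-suffix p s p≢[] s≢[] l₂≡p++s with <ₗ-cmp l₂ s
    ... | inj₁ l₂<s = l₂<s
    ... | inj₂ (inj₁ refl) = ⊥-elim (ℕ.<-irrefl (cong length l₂≡p++s) (length-proper-suffix p s p≢[]))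
    ... | inj₂ (inj₂ s<l₂) = ⊥-elim (not-below-l₂ (a ∷ q ++ p) (λ ()) l≡aqp++s s≢[] s<l₂)
      where
      l≡aqp++s : a ∷ b ∷ u ≡ (a ∷ q ++ p) ++ s
      l≡aqp++s = trans l≡l₁++l₂ (cong (a ∷_) (trans (cong (q ++_) l₂≡p++s) (sym (++-assoc q p s))))

  l₁-lyndon : IsLyndon (a ∷ q)
  l₁-lyndon = record { nonempty = λ () ; <ₗ-proper-suffix = smaller-than-suffix }
    where
    smaller-than-suffix : ∀ p s → p ≢ [] → s ≢ [] → a ∷ q ≡ p ++ s → a ∷ q <ₗ s
    smaller-than-suffix p s p≢[] s≢[] l₁≡p++s =
      [ ⊥-elim ∘ not-prefix , id ]′ (<ₗ-++⁻ (a ∷ q) s l₁l₂<sl₂ (ℕ.<⇒≤ |s|<|l₁|))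
      where
      |s|<|l₁| : length s < length (a ∷ q)
      |s|<|l₁| = subst (λ v → length s < length v) (sym l₁≡p++s) (length-proper-suffix p s p≢[])

      l₁l₂<sl₂ : (a ∷ q) ++ l₂ <ₗ s ++ l₂
      l₁l₂<sl₂ = subst (_<ₗ s ++ l₂) l≡l₁++l₂
        (<ₗ-proper-suffix p (s ++ l₂) p≢[] (s≢[] ∘ ++-conicalˡ s l₂)
          (trans l≡l₁++l₂ (trans (cong (_++ l₂) l₁≡p++s) (++-assoc p s l₂))))

      not-prefix : ¬ ∃ λ t → a ∷ q ≡ s ++ t
      not-prefix (t , l₁≡s++t) =
        not-below-l₂ s s≢[] l≡s++tl₂ (l₂≢[] ∘ ++-conicalʳ t l₂)
          (<ₗ-prefix⁻ s (subst (_<ₗ s ++ l₂) l₁l₂≡s++tl₂ l₁l₂<sl₂))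
        where
        l₁l₂≡s++tl₂ : (a ∷ q) ++ l₂ ≡ s ++ (t ++ l₂)
        l₁l₂≡s++tl₂ = trans (cong (_++ l₂) l₁≡s++t) (++-assoc s t l₂)
        l≡s++tl₂ : a ∷ b ∷ u ≡ s ++ (t ++ l₂)
        l≡s++tl₂ = trans l≡l₁++l₂ l₁l₂≡s++tl₂

allWords-sorted : (n : ℕ) → AllPairs _<ₗ_ (allWords {m} n)
allWords-sorted zero = [] ∷ []
allWords-sorted {m} (suc n) = AllPairs.concat⁺ (All.map⁺ (All.universal block-sorted (allFin m)))
                                                 (AllPairs.map⁺ (AllPairs.tabulate⁺-< blocks-ordered))
  where
  block-sorted : ∀ a → AllPairs _<ₗ_ (map (a ∷_) (allWords n))
  block-sorted a = AllPairs.map⁺ (AllPairs.map (next refl) (allWords-sorted n))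

  blocks-ordered : ∀ {a b} → a Fin.< b →
                   All (λ x → All (x <ₗ_) (map (b ∷_) (allWords n))) (map (a ∷_) (allWords n))
  blocks-ordered a<b = All.map⁺ (All.universal (λ _ → All.map⁺ (All.universal (λ _ → this a<b) _)) _)

allWords-length : (n : ℕ) → All (λ v → length v ≡ n) (allWords {m} n)
allWords-length zero = refl ∷ []
allWords-length {m} (suc n) =
  All.concat⁺ (All.map⁺ (All.universal (λ _ → All.map⁺ (All.map (cong suc) (allWords-length n))) (allFin m)))

∈-allWords : (v : Word m) → v ∈ allWords (length v)
∈-allWords [] = here refl
∈-allWords (b ∷ v) = ∈-concat⁺′ (∈-map⁺ (b ∷_) (∈-allWords v)) (∈-map⁺ (λ a → map (a ∷_) _) (∈-allFin b))

lyndonWords-sorted : (n : ℕ) → AllPairs _<ₗ_ (lyndonWords {m} n)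
lyndonWords-sorted n = AllPairs.filter⁺ _ (allWords-sorted n)

lyndonWords-lyndon : (n : ℕ) → All IsLyndon (lyndonWords {m} n)
lyndonWords-lyndon n = All.map (isLyndon⇒IsLyndon _) (All.all-filter _ (allWords n))

-- Every word occurring in P with nonzero total coefficient has length k.
Homogeneous : ℕ → Poly m → Set
Homogeneous k P = ∀ f → (∀ x → length x ≡ k → f x ≡ + 0) → ⟪ P , f ⟫ ≡ + 0

coeff-homogeneous : {k : ℕ} {P : Poly m} {u : Word m} → Homogeneous k P → length u ≢ k → coeff P u ≡ + 0
coeff-homogeneous {P = P} {u} P-hom |u|≢k =
  trans (coeff-⟪⟫ P u)
        (P-hom (δ u) (λ x |x|≡k → δ-≢ {u = u} {x} (λ x≡u → |u|≢k (subst (λ v → length v ≡ _) x≡u |x|≡k))))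

letter-homogeneous : (a : Fin m) → Homogeneous 1 (letter a)
letter-homogeneous a f f-vanishes = cong (λ z → + 1 * z + + 0) (f-vanishes (a ∷ []) refl)

bracket-homogeneous : {j k : ℕ} {P Q : Poly m} → Homogeneous j P → Homogeneous k Q →
                      Homogeneous (j ℕ.+ k) (bracket P Q)
bracket-homogeneous {j = j} {k} {P} {Q} P-hom Q-hom f f-vanishes = begin
  ⟪ bracket P Q , f ⟫           ≡⟨ ⟪⟫-bracket P Q f ⟩
  ⟪ P , Q ⊳ f ⟫ - ⟪ Q , P ⊳ f ⟫ ≡⟨ cong₂ _-_ PQ QP ⟩
  + 0 - + 0 ∎
  where
  PQ : ⟪ P , Q ⊳ f ⟫ ≡ + 0
  PQ = P-hom _ (λ x |x|≡j → Q-hom _ (λ y |y|≡k → f-vanishes (x ++ y)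
         (trans (length-++ x) (cong₂ ℕ._+_ |x|≡j |y|≡k))))
  QP : ⟪ Q , P ⊳ f ⟫ ≡ + 0
  QP = Q-hom _ (λ y |y|≡k → P-hom _ (λ x |x|≡j → f-vanishes (y ++ x)
         (trans (length-++ y) (trans (cong₂ ℕ._+_ |y|≡k |x|≡j) (ℕ.+-comm k j)))))

leftNormed-homogeneous : (b : Fin m) (r : Word m) → Homogeneous (suc (length r)) (leftNormed b r)
leftNormed-homogeneous b [] = letter-homogeneous b
leftNormed-homogeneous b (a ∷ r) =
  subst (λ k → Homogeneous k (leftNormed b (a ∷ r))) (ℕ.+-comm (suc (length r)) 1)
    (bracket-homogeneous {P = leftNormed b r} {letter a} (leftNormed-homogeneous b r) (letter-homogeneous a))

lnb-reverse : (b : Fin m) (r : Word m) → lnb (b ∷ reverse r) ≡ leftNormed b r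
lnb-reverse b [] = refl
lnb-reverse b (a ∷ r) = begin
  lnb (b ∷ reverse (a ∷ r))
    ≡⟨ cong (λ v → lnb (b ∷ v)) (unfold-reverse a r) ⟩
  foldl (λ P c → bracket P (letter c)) (letter b) (reverse r ∷ʳ a)
    ≡⟨ foldl-∷ʳ (λ P c → bracket P (letter c)) (letter b) a (reverse r) ⟩
  bracket (lnb (b ∷ reverse r)) (letter a)
    ≡⟨ cong (λ P → bracket P (letter a)) (lnb-reverse b r) ⟩
  leftNormed b (a ∷ r) ∎

lnb-homogeneous : (v : Word m) → Homogeneous (length v) (lnb v)
lnb-homogeneous [] f _ = refl
lnb-homogeneous (b ∷ u) = subst₂ Homogeneous (cong suc (length-reverse u)) lnb≡leftNormed
  (leftNormed-homogeneous b (reverse u))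
  where
  lnb≡leftNormed : leftNormed b (reverse u) ≡ lnb (b ∷ u)
  lnb≡leftNormed = trans (sym (lnb-reverse b (reverse u))) (cong (λ v → lnb (b ∷ v)) (reverse-involutive u))

lstar-adjoint : (u v : Word m) → coeff (lstar u) v ≡ coeff (lnb v) u
lstar-adjoint u v with length v ℕ.≟ length u
... | yes |v|≡|u| = coeff-formalSum-∈ (λ v → coeff (lnb v) u) allWords-unique
                                       (subst (λ k → v ∈ allWords k) |v|≡|u| (∈-allWords v))
  where
  allWords-unique : Unique (allWords (length u))
  allWords-unique = AllPairs.map <ₗ⇒≢ (allWords-sorted (length u))
... | no |v|≢|u| =
  trans (coeff-formalSum-∉ _ (allWords (length u)) (|v|≢|u| ∘ All.lookup (allWords-length _)))
        (sym (coeff-homogeneous {P = lnb v} (lnb-homogeneous v) (|v|≢|u| ∘ sym)))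

lnbTerm : Word m → LieTerm m
lnbTerm [] = zer
lnbTerm (a ∷ u) = foldl (λ t b → brk t (gen b)) (gen a) u

evalLie-lnbTerm : (v : Word m) → evalLie (lnbTerm v) ≡ lnb v
evalLie-lnbTerm [] = refl
evalLie-lnbTerm (a ∷ u) = evalLie-foldl (gen a) u
  where
  evalLie-foldl : ∀ t u → evalLie (foldl (λ t b → brk t (gen b)) t u)
                        ≡ foldl (λ P b → bracket P (letter b)) (evalLie t) u
  evalLie-foldl t [] = refl
  evalLie-foldl t (b ∷ u) = evalLie-foldl (brk t (gen b)) u

-- Standard bracketings of Lyndon words are triangular

VanishesAbove : (Word m → ℤ) → Word m → Set
VanishesAbove f l = ∀ x → length x ≡ length l → l <ₗ x → f x ≡ + 0

-- R is l plus a combination of words of the same length lexicographically greater than l.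
record Triangular (R : Poly m) (l : Word m) : Set where
  constructor mkTriangular
  field ⟪⟫-triangular : ∀ f → VanishesAbove f l → ⟪ R , f ⟫ ≡ f l
open Triangular

triangular-letter : (a : Fin m) → Triangular (letter a) (a ∷ [])
triangular-letter a = mkTriangular λ f _ → trans (ℤ.+-identityʳ _) (ℤ.*-identityˡ _)

triangular-pmul : {R₁ R₂ : Poly m} {l₁ l₂ : Word m} → Triangular R₁ l₁ → Triangular R₂ l₂ →
                  Triangular (pmul R₁ R₂) (l₁ ++ l₂)
triangular-pmul {R₁ = R₁} {R₂} {l₁} {l₂} (mkTriangular T₁) (mkTriangular T₂) = mkTriangular pairing
  where
  same-length : ∀ x y → length x ≡ length l₁ → length y ≡ length l₂ → length (x ++ y) ≡ length (l₁ ++ l₂)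
  same-length x y |x| |y| = trans (length-++ x) (trans (cong₂ ℕ._+_ |x| |y|) (sym (length-++ l₁)))

  pairing : ∀ f → VanishesAbove f (l₁ ++ l₂) → ⟪ pmul R₁ R₂ , f ⟫ ≡ f (l₁ ++ l₂)
  pairing f f-vanishes = begin
    ⟪ pmul R₁ R₂ , f ⟫ ≡⟨ ⟪⟫-pmul R₁ R₂ f ⟩
    ⟪ R₁ , R₂ ⊳ f ⟫    ≡⟨ T₁ (R₂ ⊳ f) R₂⊳f-vanishes ⟩
    (R₂ ⊳ f) l₁        ≡⟨ T₂ (λ y → f (l₁ ++ y)) l₁-shift-vanishes ⟩
    f (l₁ ++ l₂) ∎
    where
    l₁-shift-vanishes : VanishesAbove (λ y → f (l₁ ++ y)) l₂
    l₁-shift-vanishes y |y| l₂<y = f-vanishes _ (same-length l₁ y refl |y|) (<ₗ-prefix⁺ l₁ l₂<y)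

    R₂⊳f-vanishes : VanishesAbove (R₂ ⊳ f) l₁
    R₂⊳f-vanishes x |x| l₁<x = trans
      (T₂ _ (λ y |y| _ → f-vanishes _ (same-length x y |x| |y|) (<ₗ-++ _ y l₁<x (ℕ.≤-reflexive |x|))))
      (f-vanishes _ (same-length x l₂ |x| refl) (<ₗ-++ _ l₂ l₁<x (ℕ.≤-reflexive |x|)))

<ₗ-swap : (l₁ l₂ : Word m) → l₁ ++ l₂ <ₗ l₂ → l₁ ++ l₂ <ₗ l₂ ++ l₁
<ₗ-swap l₁ l₂ l<l₂ = subst (_<ₗ l₂ ++ l₁) (++-identityʳ (l₁ ++ l₂))
  (<ₗ-++ [] l₁ l<l₂ (subst (length l₂ ℕ.≤_) (sym (length-++ l₁)) (ℕ.m≤n+m (length l₂) (length l₁))))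

triangular-bracket : {R₁ R₂ : Poly m} {l₁ l₂ : Word m} → Triangular R₁ l₁ → Triangular R₂ l₂ →
                     l₁ ++ l₂ <ₗ l₂ → Triangular (bracket R₁ R₂) (l₁ ++ l₂)
triangular-bracket {R₁ = R₁} {R₂} {l₁} {l₂} T₁ T₂ l<l₂ = mkTriangular λ f f-vanishes → begin
  ⟪ bracket R₁ R₂ , f ⟫
    ≡⟨ ⟪⟫-bracket-pmul R₁ R₂ f ⟩
  ⟪ pmul R₁ R₂ , f ⟫ - ⟪ pmul R₂ R₁ , f ⟫
    ≡⟨ cong₂ _-_ (⟪⟫-triangular (triangular-pmul T₁ T₂) f f-vanishes)
                 (⟪⟫-triangular (triangular-pmul T₂ T₁) f (vanishes-above-l₂l₁ f-vanishes)) ⟩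
  f (l₁ ++ l₂) - f (l₂ ++ l₁)
    ≡⟨ cong (λ z → f (l₁ ++ l₂) - z) (f-vanishes _ same-length l<l₂l₁) ⟩
  f (l₁ ++ l₂) - + 0
    ≡⟨ ℤ.+-identityʳ _ ⟩
  f (l₁ ++ l₂) ∎
  where
  l<l₂l₁ : l₁ ++ l₂ <ₗ l₂ ++ l₁
  l<l₂l₁ = <ₗ-swap l₁ l₂ l<l₂

  same-length : length (l₂ ++ l₁) ≡ length (l₁ ++ l₂)
  same-length = trans (length-++ l₂) (trans (ℕ.+-comm (length l₂) (length l₁)) (sym (length-++ l₁)))

  vanishes-above-l₂l₁ : ∀ {f} → VanishesAbove f (l₁ ++ l₂) → VanishesAbove f (l₂ ++ l₁)
  vanishes-above-l₂l₁ f-vanishes x |x| l₂l₁<x =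
    f-vanishes x (trans |x| same-length) (<ₗ-trans l<l₂l₁ l₂l₁<x)

triangular-coeff-self : {R : Poly m} {l : Word m} → Triangular R l → coeff R l ≡ + 1
triangular-coeff-self {R = R} {l} T = trans (coeff-⟪⟫ R l)
  (trans (⟪⟫-triangular T (δ l) (λ x _ l<x → δ-≢ (<ₗ⇒≢ l<x ∘ sym))) (δ-self l))

triangular-coeff-below : {R : Poly m} {l l′ : Word m} → Triangular R l → l′ <ₗ l → coeff R l′ ≡ + 0
triangular-coeff-below {R = R} {l} {l′} T l′<l = trans (coeff-⟪⟫ R l′)
  (trans (⟪⟫-triangular T (δ l′) (λ x _ l<x → δ-≢ (<ₗ⇒≢ (<ₗ-trans l′<l l<x) ∘ sym))) (δ-≢ (<ₗ⇒≢ l′<l ∘ sym)))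

standard-bracketing : (l : Word m) → IsLyndon l → Σ (LieTerm m) λ t → Triangular (evalLie t) l
standard-bracketing l = go l (<-wellFounded (length l))
  where
  go : ∀ l → Acc _<_ (length l) → IsLyndon l → Σ (LieTerm _) λ t → Triangular (evalLie t) l
  go [] _ lyn = ⊥-elim (IsLyndon.nonempty lyn refl)
  go (a ∷ []) _ _ = gen a , triangular-letter a
  go (a ∷ b ∷ u) (acc rec) lyn with standard-factorisation a b u lyn
  ... | l₁ , l₂ , lyn₁ , lyn₂ , l≡l₁++l₂ =
    subst (λ l → Σ (LieTerm _) λ t → Triangular (evalLie t) l) (sym l≡l₁++l₂)
          (combine (go l₁ (rec (shorter (length-proper-prefix l₁ l₂ l₂≢[]))) lyn₁)
                   (go l₂ (rec (shorter (length-proper-suffix l₁ l₂ l₁≢[]))) lyn₂))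
    where
    open IsLyndon lyn₁ renaming (nonempty to l₁≢[])
    open IsLyndon lyn₂ renaming (nonempty to l₂≢[])

    shorter : ∀ {k} → k < length (l₁ ++ l₂) → k < length (a ∷ b ∷ u)
    shorter = subst (_ <_) (cong length (sym l≡l₁++l₂))

    l₁l₂<l₂ : l₁ ++ l₂ <ₗ l₂
    l₁l₂<l₂ = subst (_<ₗ l₂) l≡l₁++l₂ (IsLyndon.<ₗ-proper-suffix lyn l₁ l₂ l₁≢[] l₂≢[] l≡l₁++l₂)

    combine : Σ (LieTerm _) (λ t → Triangular (evalLie t) l₁) →
              Σ (LieTerm _) (λ t → Triangular (evalLie t) l₂) →
              Σ (LieTerm _) (λ t → Triangular (evalLie t) (l₁ ++ l₂))
    combine (t₁ , T₁) (t₂ , T₂) = brk t₁ t₂ , triangular-bracket T₁ T₂ l₁l₂<l₂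

coeff-leftNormed : (b : Fin m) (r u : Word m) → coeff (leftNormed b r) u ≡ coeff (lstar u) (b ∷ reverse r)
coeff-leftNormed b r u = trans (cong (λ P → coeff P u) (sym (lnb-reverse b r))) (sym (lstar-adjoint u _))

∣-coeff-Lie : {d : ℤ} (w : Word m) → (∀ v → d ∣ coeff (lstar w) v) → (t : LieTerm m) → d ∣ coeff (evalLie t) w
∣-coeff-Lie {d = d} w d∣l*w t = subst (d ∣_) (sym (coeff-⟪⟫ (evalLie t) w))
  (span-pairing (d ∣_) (divides (+ 0) refl) ∣m∣n⇒∣m+n ∣m⇒∣-m (δ w) on-gen (span-evalLie t))
  where
  on-gen : ∀ b r → d ∣ ⟪ leftNormed b r , δ w ⟫
  on-gen b r =
    subst (d ∣_) (trans (sym (coeff-leftNormed b r w)) (coeff-⟪⟫ (leftNormed b r) w)) (d∣l*w _)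

∣-coeff-lstar : {d : ℤ} (w : Word m) → (∀ t → d ∣ coeff (evalLie t) w) → ∀ v → d ∣ coeff (lstar w) v
∣-coeff-lstar {d = d} w d∣Lie v =
  subst (d ∣_) (trans (cong (λ P → coeff P w) (evalLie-lnbTerm v)) (sym (lstar-adjoint w v)))
        (d∣Lie (lnbTerm v))

gcd-∣-coeff-lstar : (w : Word m) (v : Word m) →
                    + gcdNonzero (map (coeff (lstar w)) (allWords (length w))) ∣ coeff (lstar w) v
gcd-∣-coeff-lstar w = ∣-coeff-formalSum _ (allWords (length w))
  (λ {v} v∈ → subst (_ ∣_) (lstar-adjoint w v) (gcdNonzero-∣ (coeff (lstar w)) v∈))

coeff-Lie-decomposition : {X : Set} (xs : List X) (ξ : X → ℤ) (l : X → Word m) (w : Word m) →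
  (∀ v → coeff (lstar w) v ≡ zsum (map (λ j → ξ j * coeff (lstar (l j)) v) xs)) →
  {P : Poly m} → Span P → coeff P w ≡ zsum (map (λ j → ξ j * coeff P (l j)) xs)
coeff-Lie-decomposition xs ξ l w l*w≡Σ {P} P∈span = begin
  coeff P w   ≡⟨ coeff-⟪⟫ P w ⟩
  ⟪ P , δ w ⟫ ≡⟨ span-⟪⟫-cong on-gen P∈span ⟩
  ⟪ P , ψ ⟫   ≡⟨ ⟪⟫-ψ P ⟩
  zsum (map (λ j → ξ j * coeff P (l j)) xs) ∎
  where
  ψ : Word _ → ℤ
  ψ x = zsum (map (λ j → ξ j * δ (l j) x) xs)

  ⟪⟫-ψ : ∀ Q → ⟪ Q , ψ ⟫ ≡ zsum (map (λ j → ξ j * coeff Q (l j)) xs)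
  ⟪⟫-ψ Q = trans (⟪⟫-zsum Q xs (λ j x → ξ j * δ (l j) x)) (cong zsum (map-cong ⟪⟫-term xs))
    where
    ⟪⟫-term : ∀ j → ⟪ Q , (λ x → ξ j * δ (l j) x) ⟫ ≡ ξ j * coeff Q (l j)
    ⟪⟫-term j = trans (⟪⟫-* Q (ξ j) (δ (l j))) (cong (ξ j *_) (sym (coeff-⟪⟫ Q (l j))))

  on-gen : ∀ b r → ⟪ leftNormed b r , δ w ⟫ ≡ ⟪ leftNormed b r , ψ ⟫
  on-gen b r = begin
    ⟪ leftNormed b r , δ w ⟫ ≡⟨ sym (coeff-⟪⟫ (leftNormed b r) w) ⟩
    coeff (leftNormed b r) w ≡⟨ coeff-leftNormed b r w ⟩
    coeff (lstar w) v       ≡⟨ l*w≡Σ v ⟩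
    zsum (map (λ j → ξ j * coeff (lstar (l j)) v) xs)
      ≡⟨ cong zsum (map-cong (λ j → cong (ξ j *_) (sym (coeff-leftNormed b r (l j)))) xs) ⟩
    zsum (map (λ j → ξ j * coeff (leftNormed b r) (l j)) xs) ≡⟨ sym (⟪⟫-ψ (leftNormed b r)) ⟩
    ⟪ leftNormed b r , ψ ⟫ ∎
    where
    v : Word _
    v = b ∷ reverse r

∣-lyndon-coordinates : (w : Word m) (ls : List (Word m)) → All IsLyndon ls → AllPairs _<ₗ_ ls →
  {d : ℤ} → (∀ t → d ∣ coeff (evalLie t) w) → (ξ : Fin (length ls) → ℤ) →
  (∀ v → coeff (lstar w) v ≡ zsum (map (λ i → ξ i * coeff (lstar (lookup ls i)) v) (allFin (length ls)))) →
  ∀ i → d ∣ ξ i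
∣-lyndon-coordinates w ls ls-lyndon ls-sorted {d} d∣Lie ξ l*w≡Σ = ∣-unitriangular d M diagonal below ξ d∣rows
  where
  standard : ∀ i → Σ (LieTerm _) λ t → Triangular (evalLie t) (lookup ls i)
  standard i = standard-bracketing (lookup ls i) (All.lookup ls-lyndon (∈-lookup i))

  M : Fin (length ls) → Fin (length ls) → ℤ
  M i j = coeff (evalLie (proj₁ (standard i))) (lookup ls j)

  diagonal : ∀ i → M i i ≡ + 1
  diagonal i = triangular-coeff-self (proj₂ (standard i))

  below : ∀ {i j} → j Fin.< i → M i j ≡ + 0
  below {i} j<i = triangular-coeff-below (proj₂ (standard i)) (AllPairs-lookup ls-sorted j<i)

  d∣rows : ∀ i → d ∣ zsum (map (λ j → ξ j * M i j) (allFin (length ls)))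
  d∣rows i =
    subst (d ∣_) (coeff-Lie-decomposition (allFin _) ξ (lookup ls) w l*w≡Σ (span-evalLie t)) (d∣Lie t)
    where
    t : LieTerm _
    t = proj₁ (standard i)

theorem2p5 : ∀ {m : ℕ} (w : Word m) (c : ℕ)
  → (∀ (z : ℤ) → (Σ (LieTerm m) (λ t → coeff (evalLie t) w ≡ z)) ⇔ ((+ c) Unsigned.∣ z))
  → (ξ : Fin (length (lyndonWords {m} (length w))) → ℤ)
  → (∀ (u : Word m) → coeff (lstar w) u
       ≡ zsum (map (λ i → ξ i * coeff (lstar (lookup (lyndonWords (length w)) i)) u)
                   (allFin (length (lyndonWords {m} (length w))))))
  → c ≡ 0 ⊎ (c ≡ gcdNonzero (map (coeff (lstar w)) (allWords (length w)))
             × c ≡ gcdNonzero (map ξ (allFin (length (lyndonWords {m} (length w))))))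
theorem2p5 {m} w c c-generates ξ l*w≡Σ = inj₂ (c≡g₁ , c≡g₂)
  where
  n g₁ g₂ : ℕ
  n = length w
  g₁ = gcdNonzero (map (coeff (lstar w)) (allWords n))
  g₂ = gcdNonzero (map ξ (allFin (length (lyndonWords {m} n))))

  c∣Lie : ∀ t → + c ∣ coeff (evalLie t) w
  c∣Lie t = ∣ᵤ⇒∣ (Equivalence.to (c-generates _) (t , refl))

  g₁∣c : g₁ ℕ.∣ c
  g₁∣c with Equivalence.from (c-generates (+ c)) ℕ.∣-refl
  ... | t , coeff≡c = ∣⇒∣ᵤ (subst (+ g₁ ∣_) coeff≡c (∣-coeff-Lie w (gcd-∣-coeff-lstar w) t))

  g₂∣l*w : ∀ v → + g₂ ∣ coeff (lstar w) v
  g₂∣l*w v = subst (+ g₂ ∣_) (sym (l*w≡Σ v))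
    (∣-zsum _ (allFin _) (λ i → ∣m⇒∣m*n _ (gcdNonzero-∣ ξ {allFin _} (∈-allFin i))))

  c≡g₁ : c ≡ g₁
  c≡g₁ = ℕ.∣-antisym (∣-gcdNonzero _ (allWords n) (∣-coeff-lstar w c∣Lie)) g₁∣c

  c∣ξ : ∀ i → + c ∣ ξ i
  c∣ξ = ∣-lyndon-coordinates w _ (lyndonWords-lyndon n) (lyndonWords-sorted n) c∣Lie ξ l*w≡Σ

  c≡g₂ : c ≡ g₂
  c≡g₂ = ℕ.∣-antisym (∣-gcdNonzero ξ (allFin _) c∣ξ) (ℕ.∣-trans (∣-gcdNonzero _ (allWords n) g₂∣l*w) g₁∣c)
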